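{- Let $G=(V,E)$ be a simple connected undirected graph with maximum degree $\Delta(G)$, and let $c\in V$. Construct a bipartite graph $\hat G=(P\sqcup Q,\hat E)$ as follows. Let $P=V$. For each $u\in V$ let $R(u)=\{r_u^1,\dots,r_u^{\Delta(G)+1-d_G(u)}\}$ be a set of new vertices, and for each edge $e\in E$ let $e^1$ be one new vertex; put $Q=\{e^1 : e\in E\}\cup\bigcup_{u\in V}R(u)$. Let $E'=\{ue^1 : e\in E,\ u \text{ an endpoint of } e\}\cup\{ur : u\in V,\ r\in R(u)\}$, and $\hat E=E'\cup\{cq : q\in Q,\ cq\notin E'\}$. Then the partition completion $C(\hat G)$ is moral.
   Context: $d_G(u)$ is the degree of $u$ in $G$. The partition completion $C(\hat G)$ is obtained from $\hat G$ by adding all edges between distinct vertices of $P$ and all edges between distinct vertices of $Q$. For a directed acyclic graph $D=(V,A)$, its moral graph is the undirected graph on $V$ in which $u\neq v$ are adjacent iff they are adjacent in $D$ or are both parents of a common vertex. An undirected graph is moral if it is the moral graph of some directed acyclic graph. -}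

module Defs where

open import Data.Nat using (ℕ; zero; suc; _+_; _∸_; _⊔_)
open import Data.Bool using (Bool; true; false; T; if_then_else_)
open import Data.Fin using (Fin; _<_)
open import Data.List using (List; map; foldr; allFin)
open import Data.Nat.ListAction using (sum)
open import Data.Product using (Σ; _×_; ∃; _,_)
open import Data.Sum using (_⊎_; inj₁; inj₂)
open import Relation.Nullary using (¬_)
open import Relation.Binary.PropositionalEquality using (_≡_)
open import Relation.Binary.Construct.Closure.ReflexiveTransitive using (Star)
open import Relation.Binary.Construct.Closure.Transitive using (TransClosure)
open import Function.Bundles using (_⇔_)

record Graph (n : ℕ) : Set where
  field
    adj    : Fin n → Fin n → Bool
    sym    : ∀ u v → adj u v ≡ adj v u
    irrefl : ∀ u → adj u u ≡ false

module _ {n : ℕ} (G : Graph n) where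
  open Graph G

  Adj : Fin n → Fin n → Set
  Adj u v = T (adj u v)

  Connected : Set
  Connected = ∀ u v → Star Adj u v

  degree : Fin n → ℕ
  degree u = sum (map (λ v → if adj u v then 1 else 0) (allFin n))

  maxDegree : ℕ
  maxDegree = foldr _⊔_ 0 (map degree (allFin n))

  EdgeVertex : Set
  EdgeVertex = Σ (Fin n × Fin n) λ { (a , b) → (a < b) × Adj a b }

  RVertex : Set
  RVertex = Σ (Fin n) λ u → Fin (maxDegree + 1 ∸ degree u)

  Q : Set
  Q = EdgeVertex ⊎ RVertex

  E' : Fin n → Q → Set
  E' p (inj₁ ((a , b) , _)) = (p ≡ a) ⊎ (p ≡ b)
  E' p (inj₂ (u , _))       = p ≡ u

  Ehat : Fin n → Fin n → Q → Set
  Ehat c p q = E' p q ⊎ (p ≡ c)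

  VHat : Set
  VHat = Fin n ⊎ Q

  CAdj : Fin n → VHat → VHat → Set
  CAdj c (inj₁ p) (inj₁ p') = ¬ (p ≡ p')
  CAdj c (inj₂ q) (inj₂ q') = ¬ (q ≡ q')
  CAdj c (inj₁ p) (inj₂ q)  = Ehat c p q
  CAdj c (inj₂ q) (inj₁ p)  = Ehat c p q

Acyclic : {V : Set} → (V → V → Set) → Set
Acyclic {V} D = ∀ (v : V) → ¬ TransClosure D v v

MoralAdj : {V : Set} → (V → V → Set) → V → V → Set
MoralAdj D u v = ¬ (u ≡ v) × (D u v ⊎ D v u ⊎ ∃ λ w → D u w × D v w)

Moral : {V : Set} → (V → V → Set) → Set₁
Moral {V} H = Σ (V → V → Set) λ D → Acyclic D × (∀ u v → H u v ⇔ MoralAdj D u v)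

-- Orient the clique on P along the order of Fin n, direct every edge of E' from P to Q, and
-- choose one vertex r of R(c) (there is one since d(c) ≤ Δ) as a sink into which every other
-- vertex of Q points. In the moral graph of this DAG, Q becomes a clique because any two of
-- its vertices share the child r, and c becomes adjacent to all of Q for the same reason,
-- since c → r is an edge of E'. Nothing else gets married, as r is the only vertex of Q
-- with parents in Q.
module Submission where

open import Defs
open import Data.Nat using (ℕ; _+_; _∸_; _⊔_; _≤_; z<s)
open import Data.Nat.Properties using (m≤m⊔n; m≤n⊔m; ≤-trans; ≤-<-trans; m<m+n; m<n⇒0<n∸m)
open import Data.Fin using (Fin; fromℕ<)
open import Data.Fin.Properties using (_≟_; <-isStrictTotalOrder)
open import Data.List using (List; map; foldr; _∷_)
open import Data.List.Membership.Propositional using (_∈_)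
open import Data.List.Membership.Propositional.Properties using (∈-allFin)
open import Data.List.Relation.Unary.Any using (here; there)
open import Data.Product using (_×_; _,_)
open import Data.Product.Properties using (≡-dec)
open import Data.Sum using (_⊎_; inj₁; inj₂)
open import Data.Sum.Properties using (inj₁-injective; inj₂-injective)
open import Data.Sum.Relation.Binary.LeftOrder using (_⊎-<_; ₁∼₂; ₁∼₁; ₂∼₂; ⊎-<-transitive)
open import Data.Empty using (⊥; ⊥-elim)
open import Function using (_∘_)
open import Function.Bundles using (_⇔_; mk⇔)
open import Function.Construct.Identity using (⇔-id)
open import Function.Construct.Composition using (_⇔-∘_)
open import Relation.Nullary using (yes; no)
import Relation.Nullary.Decidable as Dec
open import Relation.Unary using (Decidable)
open import Relation.Binary using (Rel; _⇒_; Transitive; Irreflexive; IsStrictTotalOrder; DecidableEquality; tri<; tri≈; tri>)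
open import Relation.Binary.PropositionalEquality using (_≡_; _≢_; refl; sym; cong; subst)
open import Relation.Binary.Construct.Closure.Transitive using (TransClosure; [_]; _∷_)
open import Level using (0ℓ)

foldr-⊔-upperBound : ∀ {A : Set} (f : A → ℕ) {x : A} {xs : List A} →
                     x ∈ xs → f x ≤ foldr _⊔_ 0 (map f xs)
foldr-⊔-upperBound f {xs = y ∷ ys} (here refl) = m≤m⊔n (f y) _
foldr-⊔-upperBound f {xs = y ∷ ys} (there x∈ys) =
  ≤-trans (foldr-⊔-upperBound f x∈ys) (m≤n⊔m (f y) _)

degree≤maxDegree : ∀ {n} (G : Graph n) (u : Fin n) → degree G u ≤ maxDegree G
degree≤maxDegree G u = foldr-⊔-upperBound (degree G) (∈-allFin u)

≟inj₂ : ∀ {A B : Set} → DecidableEquality B → (b : B) → Decidable (λ (x : A ⊎ B) → x ≡ inj₂ b)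
≟inj₂ _≟ᴮ_ b (inj₁ a)  = no λ ()
≟inj₂ _≟ᴮ_ b (inj₂ b′) = Dec.map′ (cong inj₂) inj₂-injective (b′ ≟ᴮ b)

MoralAdj-sym : ∀ {V : Set} (D : Rel V 0ℓ) {u v : V} → MoralAdj D u v → MoralAdj D v u
MoralAdj-sym D (u≢v , inj₁ uv)                   = u≢v ∘ sym , inj₂ (inj₁ uv)
MoralAdj-sym D (u≢v , inj₂ (inj₁ vu))            = u≢v ∘ sym , inj₁ vu
MoralAdj-sym D (u≢v , inj₂ (inj₂ (w , uw , vw))) = u≢v ∘ sym , inj₂ (inj₂ (w , vw , uw))

Moral-resp-⇔ : ∀ {V : Set} {H H′ : Rel V 0ℓ} → (∀ u v → H u v ⇔ H′ u v) → Moral H′ → Moral H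
Moral-resp-⇔ H⇔H′ (D , D-acyclic , H′⇔moral) =
  D , D-acyclic , λ u v → H′⇔moral u v ⇔-∘ H⇔H′ u v

⇒-strict⇒Acyclic : ∀ {V : Set} {D _<_ : Rel V 0ℓ} →
                   Transitive _<_ → Irreflexive _≡_ _<_ → D ⇒ _<_ → Acyclic D
⇒-strict⇒Acyclic {D = D} {_<_} <-trans <-irrefl D⇒< v cycle = <-irrefl refl (D⁺⇒< cycle)
  where
  D⁺⇒< : TransClosure D ⇒ _<_
  D⁺⇒< [ d ]     = D⇒< d
  D⁺⇒< (d ∷ d⁺) = <-trans (D⇒< d) (D⁺⇒< d⁺)

PartitionCompletion : {P Q : Set} → (P → Q → Set) → Rel (P ⊎ Q) 0ℓ
PartitionCompletion B (inj₁ p) (inj₁ p′) = p ≢ p′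
PartitionCompletion B (inj₂ q) (inj₂ q′) = q ≢ q′
PartitionCompletion B (inj₁ p) (inj₂ q)  = B p q
PartitionCompletion B (inj₂ q) (inj₁ p)  = B p q

module SinkOrientation {P Q : Set} {_<_ : Rel P 0ℓ} (<-isSTO : IsStrictTotalOrder _≡_ _<_)
                       (E : P → Q → Set) (s : Q) (_≟s : Decidable (_≡ s)) where

  open IsStrictTotalOrder <-isSTO using (compare) renaming (trans to <-trans)

  IntoSink : Rel Q 0ℓ
  IntoSink q q′ = q ≢ s × q′ ≡ s

  IntoSink-trans : Transitive IntoSink
  IntoSink-trans (_ , q′≡s) (q′≢s , _) = ⊥-elim (q′≢s q′≡s)

  orientation : Rel (P ⊎ Q) 0ℓ
  orientation (inj₁ p) (inj₁ p′) = p < p′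
  orientation (inj₁ p) (inj₂ q)  = E p q
  orientation (inj₂ q) (inj₂ q′) = IntoSink q q′
  orientation (inj₂ q) (inj₁ p)  = ⊥

  orientation⇒⊎-< : orientation ⇒ (_<_ ⊎-< IntoSink)
  orientation⇒⊎-< {inj₁ p} {inj₁ p′} p<p′ = ₁∼₁ p<p′
  orientation⇒⊎-< {inj₁ p} {inj₂ q}  _    = ₁∼₂
  orientation⇒⊎-< {inj₂ q} {inj₂ q′} q↝q′ = ₂∼₂ q↝q′

  orientation-acyclic : Acyclic orientation
  orientation-acyclic = ⇒-strict⇒Acyclic (⊎-<-transitive <-trans IntoSink-trans) irrefl orientation⇒⊎-<
    where
    irrefl : Irreflexive _≡_ (_<_ ⊎-< IntoSink)
    irrefl refl (₁∼₁ p<p) = IsStrictTotalOrder.irrefl <-isSTO refl p<p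
    irrefl refl (₂∼₂ (q≢s , q≡s)) = q≢s q≡s

  _∼_ : Rel (P ⊎ Q) 0ℓ
  _∼_ = MoralAdj orientation

  P-clique : ∀ {p p′} → p ≢ p′ → inj₁ p ∼ inj₁ p′
  P-clique {p} {p′} p≢p′ with compare p p′
  ... | tri< p<p′ _ _ = p≢p′ ∘ inj₁-injective , inj₁ p<p′
  ... | tri≈ _ p≡p′ _ = ⊥-elim (p≢p′ p≡p′)
  ... | tri> _ _ p′<p = p≢p′ ∘ inj₁-injective , inj₂ (inj₁ p′<p)

  Q-clique : ∀ {q q′} → q ≢ q′ → inj₂ q ∼ inj₂ q′
  Q-clique {q} {q′} q≢q′ with q ≟s | q′ ≟s
  ... | _        | yes q′≡s = q≢q′ ∘ inj₂-injective , inj₁ (q≢s , q′≡s)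
    where
    q≢s : q ≢ s
    q≢s q≡s = q≢q′ (subst (q ≡_) (sym q′≡s) q≡s)
  ... | yes q≡s | no q′≢s  = q≢q′ ∘ inj₂-injective , inj₂ (inj₁ (q′≢s , q≡s))
  ... | no q≢s  | no q′≢s  = q≢q′ ∘ inj₂-injective , inj₂ (inj₂ (inj₂ s , (q≢s , refl) , (q′≢s , refl)))

  PQ-edge : ∀ {p q} → E p q ⊎ E p s → inj₁ p ∼ inj₂ q
  PQ-edge (inj₁ pq) = (λ ()) , inj₁ pq
  PQ-edge {p} {q} (inj₂ ps) with q ≟s
  ... | yes refl = (λ ()) , inj₁ ps
  ... | no q≢s   = (λ ()) , inj₂ (inj₂ (inj₂ s , ps , (q≢s , refl)))

  PQ-edge⁻ : ∀ {p q} → inj₁ p ∼ inj₂ q → E p q ⊎ E p s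
  PQ-edge⁻ (_ , inj₁ pq) = inj₁ pq
  PQ-edge⁻ (_ , inj₂ (inj₂ (inj₂ _ , pw , (_ , refl)))) = inj₂ pw

  orientation-moral : Moral (PartitionCompletion (λ p q → E p q ⊎ E p s))
  orientation-moral = orientation , orientation-acyclic , moralises
    where
    moralises : ∀ u v → PartitionCompletion (λ p q → E p q ⊎ E p s) u v ⇔ u ∼ v
    moralises (inj₁ p) (inj₁ p′) = mk⇔ P-clique (λ (u≢v , _) → u≢v ∘ cong inj₁)
    moralises (inj₂ q) (inj₂ q′) = mk⇔ Q-clique (λ (u≢v , _) → u≢v ∘ cong inj₂)
    moralises (inj₁ p) (inj₂ q)  = mk⇔ PQ-edge PQ-edge⁻
    moralises (inj₂ q) (inj₁ p)  =
      mk⇔ (MoralAdj-sym orientation ∘ PQ-edge) (PQ-edge⁻ ∘ MoralAdj-sym orientation)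

module _ {n : ℕ} (G : Graph n) (c : Fin n) where

  sinkLabel : Fin (maxDegree G + 1 ∸ degree G c)
  sinkLabel = fromℕ< (m<n⇒0<n∸m (≤-<-trans (degree≤maxDegree G c) (m<m+n (maxDegree G) z<s)))

  sink : Q G
  sink = inj₂ (c , sinkLabel)

  _≟sink : Decidable (_≡ sink)
  _≟sink = ≟inj₂ (≡-dec _≟_ _≟_) (c , sinkLabel)

  CAdj⇔PartitionCompletion : ∀ u v → CAdj G c u v ⇔ PartitionCompletion (Ehat G c) u v
  CAdj⇔PartitionCompletion (inj₁ p) (inj₁ p′) = ⇔-id _
  CAdj⇔PartitionCompletion (inj₂ q) (inj₂ q′) = ⇔-id _
  CAdj⇔PartitionCompletion (inj₁ p) (inj₂ q)  = ⇔-id _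
  CAdj⇔PartitionCompletion (inj₂ q) (inj₁ p)  = ⇔-id _

-- The types match because E' G p (sink G c) reduces to p ≡ c, so Ehat G c p q is
-- literally E' G p q ⊎ E' G p (sink G c).
lemma9 : ∀ {n : ℕ} (G : Graph n) → Connected G → (c : Fin n) → Moral (CAdj G c)
lemma9 G _ c = Moral-resp-⇔ (CAdj⇔PartitionCompletion G c)
  (SinkOrientation.orientation-moral <-isStrictTotalOrder (E' G) (sink G c) (_≟sink G c))
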